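{- For every integer $l\geq 6$ there exists a connected port-labeled graph $G_l$ with $(l+2)2^l$ nodes, at most $2^{2l}$ edges, and diameter at most $3$, which contains a pair of nodes $a_l,b_l$ such that $\mathcal{V}(a_l)\neq\mathcal{V}(b_l)$ and $\mathcal{V}_{l-1}(a_l)=\mathcal{V}_{l-1}(b_l)$.
   Context: A port-labeled graph is a simple undirected graph $G$ in which, for every node $v$ of degree $k$, the edges incident to $v$ are labeled bijectively by port numbers $\{1,\ldots,k\}$; write $\lambda(u,v)$ for the port number at $u$ of edge $\{u,v\}$. The truncated view $\mathcal{V}_l(v)$ is the rooted port-labeled tree defined recursively: $\mathcal{V}_0(v)$ is a single root $x_0$; $\mathcal{V}_{l+1}(v)$ has root $x_0$ with one child $x_i$ per neighbor $v_i$ of $v$, the edge $\{x_0,x_i\}$ carrying port $\lambda(v,v_i)$ at $x_0$ and $\lambda(v_i,v)$ at $x_i$, and the subtree at $x_i$ equal to $\mathcal{V}_l(v_i)$. The view $\mathcal{V}(v)$ is the infinite rooted port-labeled tree whose truncation to depth $l$ is $\mathcal{V}_l(v)$ for all $l\ge 0$. -}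

module Defs where

open import Data.Nat using (ℕ; zero; suc; _+_; _<_)
open import Data.Nat.Properties using (_<?_)
open import Data.Fin using (Fin; toℕ)
open import Data.List using (List; []; tabulate)
open import Data.Nat.ListAction using (sum)
open import Data.Product using (_×_; _,_; Σ; ∃)
open import Relation.Binary.PropositionalEquality using (_≡_; _≢_)
open import Relation.Nullary using (¬_; yes; no)
open import Function.Definitions using (Injective)

-- Node v has degree deg v; its ports are Fin (deg v), where port p : Fin k
-- stands for port number toℕ p + 1 ∈ {1,…,k}.  nbr v p is the neighbour
-- reached through port p of v (this labels the incident edges of v
-- bijectively by ports, since nbr v is injective and its image is exactly
-- the neighbourhood of v), and rev v p is the port number of that same edge
-- at the other endpoint.
record PortGraph (n : ℕ) : Set where
  field
    deg      : Fin n → ℕ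
    nbr      : (v : Fin n) → Fin (deg v) → Fin n
    rev      : (v : Fin n) (p : Fin (deg v)) → Fin (deg (nbr v p))
    rev-back : (v : Fin n) (p : Fin (deg v)) → nbr (nbr v p) (rev v p) ≡ v
    no-loop  : (v : Fin n) (p : Fin (deg v)) → nbr v p ≢ v
    no-multi : (v : Fin n) → Injective _≡_ _≡_ (nbr v)

open PortGraph public

module _ {n : ℕ} (G : PortGraph n) where

  -- number of edges: each edge {u,v} counted once, from its smaller endpoint
  countUp : Fin n → ℕ
  countUp u = sum (tabulate {n = deg G u} λ p → indicator (nbr G u p))
    where
    indicator : Fin n → ℕ
    indicator w with toℕ u <? toℕ w
    ... | yes _ = 1
    ... | no  _ = 0

  numEdges : ℕ
  numEdges = sum (tabulate {n = n} countUp)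

  data Walk : ℕ → Fin n → Fin n → Set where
    here : ∀ {v} → Walk zero v v
    step : ∀ {k u w} (p : Fin (deg G u)) → Walk k (nbr G u p) w → Walk (suc k) u w

  Connected : Set
  Connected = (u v : Fin n) → ∃ λ k → Walk k u v

  DiameterAtMost : ℕ → Set
  DiameterAtMost d = (u v : Fin n) → ∃ λ k → k Data.Nat.≤ d × Walk k u v

-- The children of the root are listed in
-- increasing order of their port number at the root; each child entry
-- records (port at parent, port at child, subtree).  Since the ports at the
-- root are distinct, this list is a canonical representation, so ≡ on Tree
-- is isomorphism of rooted port-labeled trees.
data Tree : Set where
  node : List (ℕ × ℕ × Tree) → Tree

module _ {n : ℕ} (G : PortGraph n) where

  -- truncated view 𝒱_l(v)  (ports shifted to 1-based numbering)
  view : ℕ → Fin n → Tree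
  view zero    v = node []
  view (suc l) v = node (tabulate {n = deg G v}
                      λ p → (suc (toℕ p) , suc (toℕ (rev G v p)) , view l (nbr G v p)))

  -- the (infinite) view 𝒱(v) is determined by all its truncations, so
  -- 𝒱(a) = 𝒱(b) iff 𝒱_l(a) = 𝒱_l(b) for every l.
  SameView : Fin n → Fin n → Set
  SameView a b = (l : ℕ) → view l a ≡ view l b

-- For every code s ∈ {0,1}^l there is a hub node and a ring of l + 1 nodes. Hub s is joined to
-- hub s ⊕ d through the port encoding d, so that all hubs look alike, and to every node of its
-- ring; this gives diameter 3, and as each pair of hubs is one edge, at most 2^(2l) edges once
-- 8(l + 1) ≤ 2^l. The ring edge from position c to c + 1 swaps bits c − 1 and c of the code, and
-- at position 0 a leading bit 1 exchanges the two ring ports. The walk from position l down to 0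
-- thus carries bit l − 1 to the front, so the views of the position-l nodes of the codes 0 and
-- e_(l−1) differ at depth l. Yet a depth-k view only sees the first k bits of the code, because
-- each step moves a bit by at most one position, and these two codes share their first l − 1 bits.

module Submission where

open import Defs
open import Data.Nat using (ℕ; zero; suc; _+_; _*_; _^_; _≤_; _<_; _∸_; z≤n; s≤s)
open import Data.Nat.Properties
open import Data.Nat.Solver using (module +-*-Solver)
open import Data.Nat.ListAction using (sum)
open import Data.Fin using (Fin; zero; suc; toℕ; fromℕ; inject₁; cast; _↑ˡ_; _↑ʳ_; splitAt; join; combine; remQuot)
open import Data.Fin.Properties
  using (toℕ-cast; cast-is-id; toℕ-fromℕ; toℕ-inject₁; toℕ-injective; splitAt-↑ˡ; splitAt-↑ʳ; join-splitAt;
         remQuot-combine; combine-remQuot; 2↔Bool)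
  renaming (suc-injective to Fin-suc-injective)
open import Data.Bool using (Bool; true; false; not; _∧_; _xor_; if_then_else_)
open import Data.Bool.Properties using (xor-assoc; xor-same; xor-identityʳ; not-¬)
open import Data.Vec using (Vec; []; _∷_; head; replicate; zipWith)
open import Data.List using ([]; _∷_; tabulate)
open import Data.List.Properties using (tabulate-cong)
open import Data.Product using (Σ; ∃; _×_; _,_; proj₁; proj₂)
open import Data.Sum using (_⊎_; inj₁; inj₂)
open import Data.Unit using (⊤; tt)
open import Data.Empty using (⊥; ⊥-elim)
open import Function using (_∘_)
open import Function.Bundles using (_↔_; Inverse; mk↔ₛ′)
open import Function.Definitions using (Injective)
open import Relation.Binary.PropositionalEquality
open import Relation.Nullary using (¬_; yes; no; contradiction)
open import Algebra.Properties.CommutativeSemigroup +-commutativeSemigroup using (interchange)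

∑ : ∀ {k} → (Fin k → ℕ) → ℕ
∑ f = sum (tabulate f)

∑-cong : ∀ {k} {f g : Fin k → ℕ} → (∀ i → f i ≡ g i) → ∑ f ≡ ∑ g
∑-cong f≗g = cong sum (tabulate-cong f≗g)

∑-mono-≤ : ∀ {k} {f g : Fin k → ℕ} → (∀ i → f i ≤ g i) → ∑ f ≤ ∑ g
∑-mono-≤ {zero}  f≤g = z≤n
∑-mono-≤ {suc k} f≤g = +-mono-≤ (f≤g zero) (∑-mono-≤ (λ i → f≤g (suc i)))

∑-≤-* : ∀ {k} c {f : Fin k → ℕ} → (∀ i → f i ≤ c) → ∑ f ≤ k * c
∑-≤-* {zero}  c f≤c = z≤n
∑-≤-* {suc k} c f≤c = +-mono-≤ (f≤c zero) (∑-≤-* c (λ i → f≤c (suc i)))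

∑-↑ : ∀ m {n} (f : Fin (m + n) → ℕ) → ∑ f ≡ ∑ (λ i → f (i ↑ˡ n)) + ∑ (λ j → f (m ↑ʳ j))
∑-↑ zero    f = refl
∑-↑ (suc m) f = trans (cong (f zero +_) (∑-↑ m (λ i → f (suc i)))) (sym (+-assoc (f zero) _ _))

∑-combine : ∀ m {n} (f : Fin (m * n) → ℕ) → ∑ f ≡ ∑ {m} (λ i → ∑ {n} (λ j → f (combine i j)))
∑-combine zero    f = refl
∑-combine (suc m) {n} f =
  trans (∑-↑ n f) (cong (∑ (λ j → f (j ↑ˡ (m * n))) +_) (∑-combine m (λ i → f (n ↑ʳ i))))

-- Bit vectors

Bits : ℕ → Set
Bits = Vec Bool

0ᵇ : ∀ {k} → Bits k
0ᵇ = replicate _ false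

infixl 6 _⊕_
_⊕_ : ∀ {k} → Bits k → Bits k → Bits k
_⊕_ = zipWith _xor_

⊕-assoc : ∀ {k} (s t u : Bits k) → (s ⊕ t) ⊕ u ≡ s ⊕ (t ⊕ u)
⊕-assoc []      []      []      = refl
⊕-assoc (x ∷ s) (y ∷ t) (z ∷ u) = cong₂ _∷_ (xor-assoc x y z) (⊕-assoc s t u)

⊕-identityˡ : ∀ {k} (s : Bits k) → 0ᵇ ⊕ s ≡ s
⊕-identityˡ []      = refl
⊕-identityˡ (x ∷ s) = cong (x ∷_) (⊕-identityˡ s)

⊕-identityʳ : ∀ {k} (s : Bits k) → s ⊕ 0ᵇ ≡ s
⊕-identityʳ []      = refl
⊕-identityʳ (x ∷ s) = cong₂ _∷_ (xor-identityʳ x) (⊕-identityʳ s)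

⊕-self : ∀ {k} (s : Bits k) → s ⊕ s ≡ 0ᵇ
⊕-self []      = refl
⊕-self (x ∷ s) = cong₂ _∷_ (xor-same x) (⊕-self s)

⊕-cancelʳ : ∀ {k} (s d : Bits k) → s ⊕ d ⊕ d ≡ s
⊕-cancelʳ s d = begin
  s ⊕ d ⊕ d   ≡⟨ ⊕-assoc s d d ⟩
  s ⊕ (d ⊕ d) ≡⟨ cong (s ⊕_) (⊕-self d) ⟩
  s ⊕ 0ᵇ      ≡⟨ ⊕-identityʳ s ⟩
  s           ∎
  where open ≡-Reasoning

⊕-cancelˡ : ∀ {k} (s t : Bits k) → s ⊕ (s ⊕ t) ≡ t
⊕-cancelˡ s t = begin
  s ⊕ (s ⊕ t) ≡⟨ ⊕-assoc s s t ⟨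
  s ⊕ s ⊕ t   ≡⟨ cong (_⊕ t) (⊕-self s) ⟩
  0ᵇ ⊕ t      ≡⟨ ⊕-identityˡ t ⟩
  t           ∎
  where open ≡-Reasoning

⊕-injectiveˡ : ∀ {k} (s : Bits k) {d d′ : Bits k} → s ⊕ d ≡ s ⊕ d′ → d ≡ d′
⊕-injectiveˡ s {d} {d′} eq = begin
  d           ≡⟨ ⊕-cancelˡ s d ⟨
  s ⊕ (s ⊕ d) ≡⟨ cong (s ⊕_) eq ⟩
  s ⊕ (s ⊕ d′) ≡⟨ ⊕-cancelˡ s d′ ⟩
  d′          ∎
  where open ≡-Reasoning

⊕≡0ᵇ⇒≡ : ∀ {k} {s t : Bits k} → s ⊕ t ≡ 0ᵇ → s ≡ t
⊕≡0ᵇ⇒≡ {s = s} {t} eq = begin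
  s         ≡⟨ ⊕-cancelʳ s t ⟨
  s ⊕ t ⊕ t ≡⟨ cong (_⊕ t) eq ⟩
  0ᵇ ⊕ t    ≡⟨ ⊕-identityˡ t ⟩
  t         ∎
  where open ≡-Reasoning

isZero : ∀ {k} → Bits k → Bool
isZero []      = true
isZero (x ∷ s) = not x ∧ isZero s

isZero-0ᵇ : ∀ k → isZero (0ᵇ {k}) ≡ true
isZero-0ᵇ zero    = refl
isZero-0ᵇ (suc k) = isZero-0ᵇ k

isZero⇒≡0ᵇ : ∀ {k} (s : Bits k) → isZero s ≡ true → s ≡ 0ᵇ
isZero⇒≡0ᵇ []          _  = refl
isZero⇒≡0ᵇ (false ∷ s) eq = cong (false ∷_) (isZero⇒≡0ᵇ s eq)

encode : ∀ {k} → Bits k → Fin (2 ^ k)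
encode []      = zero
encode (x ∷ s) = combine (Inverse.from 2↔Bool x) (encode s)

decode : ∀ {k} → Fin (2 ^ k) → Bits k
decode {zero}  _ = []
decode {suc k} q = consᵇ (remQuot (2 ^ k) q)
  where
  consᵇ : Fin 2 × Fin (2 ^ k) → Bits (suc k)
  consᵇ (i , j) = Inverse.to 2↔Bool i ∷ decode j

decode-encode : ∀ {k} (s : Bits k) → decode (encode s) ≡ s
decode-encode []      = refl
decode-encode {suc k} (x ∷ s) =
  trans (cong (λ (ij : Fin 2 × Fin (2 ^ k)) → Inverse.to 2↔Bool (proj₁ ij) ∷ decode (proj₂ ij))
              (remQuot-combine (Inverse.from 2↔Bool x) (encode s)))
        (cong₂ _∷_ (Inverse.strictlyInverseˡ 2↔Bool x) (decode-encode s))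

encode-decode : ∀ {k} (q : Fin (2 ^ k)) → encode (decode {k} q) ≡ q
encode-decode {zero}  zero = refl
encode-decode {suc k} q =
  trans (cong₂ (combine {2} {2 ^ k}) (Inverse.strictlyInverseʳ 2↔Bool i) (encode-decode {k} j))
        (combine-remQuot {2} (2 ^ k) q)
  where
  i : Fin 2
  i = proj₁ (remQuot (2 ^ k) q)
  j : Fin (2 ^ k)
  j = proj₂ (remQuot (2 ^ k) q)

decode-injective : ∀ {k} {q q′ : Fin (2 ^ k)} → decode {k} q ≡ decode q′ → q ≡ q′
decode-injective {k} {q} {q′} eq =
  trans (sym (encode-decode {k} q)) (trans (cong encode eq) (encode-decode {k} q′))

∑ᵇ : ∀ {k} → (Bits k → ℕ) → ℕ
∑ᵇ {zero}  f = f []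
∑ᵇ {suc k} f = ∑ᵇ (λ s → f (false ∷ s)) + ∑ᵇ (λ s → f (true ∷ s))

∑ᵇ-cong : ∀ {k} {f g : Bits k → ℕ} → (∀ s → f s ≡ g s) → ∑ᵇ f ≡ ∑ᵇ g
∑ᵇ-cong {zero}  f≗g = f≗g []
∑ᵇ-cong {suc k} f≗g = cong₂ _+_ (∑ᵇ-cong (λ s → f≗g (false ∷ s))) (∑ᵇ-cong (λ s → f≗g (true ∷ s)))

∑ᵇ-mono-≤ : ∀ {k} {f g : Bits k → ℕ} → (∀ s → f s ≤ g s) → ∑ᵇ f ≤ ∑ᵇ g
∑ᵇ-mono-≤ {zero}  f≤g = f≤g []
∑ᵇ-mono-≤ {suc k} f≤g = +-mono-≤ (∑ᵇ-mono-≤ (λ s → f≤g (false ∷ s))) (∑ᵇ-mono-≤ (λ s → f≤g (true ∷ s)))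

∑ᵇ-distrib-+ : ∀ {k} (f g : Bits k → ℕ) → ∑ᵇ (λ s → f s + g s) ≡ ∑ᵇ f + ∑ᵇ g
∑ᵇ-distrib-+ {zero}  f g = refl
∑ᵇ-distrib-+ {suc k} f g =
  trans (cong₂ _+_ (∑ᵇ-distrib-+ (λ s → f (false ∷ s)) (λ s → g (false ∷ s)))
                   (∑ᵇ-distrib-+ (λ s → f (true ∷ s)) (λ s → g (true ∷ s))))
        (interchange (∑ᵇ (λ s → f (false ∷ s))) (∑ᵇ (λ s → g (false ∷ s)))
                     (∑ᵇ (λ s → f (true ∷ s))) (∑ᵇ (λ s → g (true ∷ s))))

∑ᵇ-const : ∀ k c → ∑ᵇ {k} (λ _ → c) ≡ 2 ^ k * c
∑ᵇ-const zero    c = sym (+-identityʳ c)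
∑ᵇ-const (suc k) c = begin
  ∑ᵇ {k} (λ _ → c) + ∑ᵇ {k} (λ _ → c) ≡⟨ cong₂ _+_ (∑ᵇ-const k c) (∑ᵇ-const k c) ⟩
  2 ^ k * c + 2 ^ k * c              ≡⟨ *-distribʳ-+ c (2 ^ k) (2 ^ k) ⟨
  (2 ^ k + 2 ^ k) * c                ≡⟨ cong (λ x → (2 ^ k + x) * c) (+-identityʳ (2 ^ k)) ⟨
  2 ^ suc k * c                      ∎
  where open ≡-Reasoning

∑ᵇ-comm : ∀ {k j} (f : Bits k → Bits j → ℕ) → ∑ᵇ (λ s → ∑ᵇ (f s)) ≡ ∑ᵇ (λ d → ∑ᵇ (λ s → f s d))
∑ᵇ-comm {zero}  f = refl
∑ᵇ-comm {suc k} f =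
  trans (cong₂ _+_ (∑ᵇ-comm (λ s → f (false ∷ s))) (∑ᵇ-comm (λ s → f (true ∷ s))))
        (sym (∑ᵇ-distrib-+ (λ d → ∑ᵇ (λ s → f (false ∷ s) d)) (λ d → ∑ᵇ (λ s → f (true ∷ s) d))))

∑ᵇ-⊕ : ∀ {k} (f : Bits k → ℕ) (d : Bits k) → ∑ᵇ (λ s → f (s ⊕ d)) ≡ ∑ᵇ f
∑ᵇ-⊕ {zero}  f []          = refl
∑ᵇ-⊕ {suc k} f (false ∷ d) = cong₂ _+_ (∑ᵇ-⊕ (λ s → f (false ∷ s)) d) (∑ᵇ-⊕ (λ s → f (true ∷ s)) d)
∑ᵇ-⊕ {suc k} f (true ∷ d)  =
  trans (cong₂ _+_ (∑ᵇ-⊕ (λ s → f (true ∷ s)) d) (∑ᵇ-⊕ (λ s → f (false ∷ s)) d))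
        (+-comm (∑ᵇ (λ s → f (true ∷ s))) _)

∑-encode : ∀ k (f : Fin (2 ^ k) → ℕ) → ∑ f ≡ ∑ᵇ {k} (λ s → f (encode s))
∑-encode zero    f = +-identityʳ (f zero)
∑-encode (suc k) f = begin
  ∑ f
    ≡⟨ ∑-combine 2 {2 ^ k} f ⟩
  ∑ {2 ^ k} (λ j → f (combine {2} zero j)) + (∑ {2 ^ k} (λ j → f (combine {2} (suc zero) j)) + 0)
    ≡⟨ cong₂ _+_ (∑-encode k _) (trans (+-identityʳ _) (∑-encode k _)) ⟩
  ∑ᵇ {suc k} (λ s → f (encode s))                               ∎
  where open ≡-Reasoning

∑ᵇ-isZero : ∀ k → ∑ᵇ {k} (λ d → if isZero d then 1 else 0) ≡ 1
∑ᵇ-isZero zero    = refl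
∑ᵇ-isZero (suc k) = begin
  ∑ᵇ {k} (λ d → if isZero d then 1 else 0) + ∑ᵇ {k} (λ _ → 0) ≡⟨ cong₂ _+_ (∑ᵇ-isZero k) (∑ᵇ-const k 0) ⟩
  1 + 2 ^ k * 0                                             ≡⟨ cong suc (*-zeroʳ (2 ^ k)) ⟩
  1                                                         ∎
  where open ≡-Reasoning

𝟙[_<_] : ℕ → ℕ → ℕ
𝟙[ a < b ] with a <? b
... | yes _ = 1
... | no  _ = 0

𝟙<-≤1 : ∀ a b → 𝟙[ a < b ] ≤ 1
𝟙<-≤1 a b with a <? b
... | yes _ = ≤-refl
... | no  _ = z≤n

𝟙<-asym : ∀ a b → 𝟙[ a < b ] + 𝟙[ b < a ] ≤ 1
𝟙<-asym a b with a <? b | b <? a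
... | yes a<b | yes b<a = contradiction b<a (<-asym a<b)
... | yes _   | no  _   = ≤-refl
... | no  _   | yes _   = ≤-refl
... | no  _   | no  _   = z≤n

-- The substitution s ↦ s ⊕ d turns increasing pairs (s, s ⊕ d) into decreasing ones.
∑ᵇ-increasing-pairs : ∀ {k} (e : Bits k → ℕ) →
  2 * ∑ᵇ (λ s → ∑ᵇ (λ d → 𝟙[ e s < e (s ⊕ d) ])) ≤ 2 ^ k * (2 ^ k * 1)
∑ᵇ-increasing-pairs {k} e = begin
  2 * T                                                   ≡⟨ cong (T +_) (+-identityʳ T) ⟩
  T + T                                                   ≡⟨ cong (T +_) T≡T′ ⟩
  T + T′                                                  ≡⟨ ∑ᵇ-distrib-+ (λ s → ∑ᵇ (up s)) (λ s → ∑ᵇ (down s)) ⟨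
  ∑ᵇ (λ s → ∑ᵇ (up s) + ∑ᵇ (down s))                      ≡⟨ ∑ᵇ-cong (λ s → ∑ᵇ-distrib-+ (up s) (down s)) ⟨
  ∑ᵇ (λ s → ∑ᵇ (λ d → up s d + down s d))                 ≤⟨ ∑ᵇ-mono-≤ (λ s → ∑ᵇ-mono-≤ (λ d → 𝟙<-asym (e s) (e (s ⊕ d)))) ⟩
  ∑ᵇ {k} (λ _ → ∑ᵇ {k} (λ _ → 1))                         ≡⟨ trans (∑ᵇ-cong {k} (λ _ → ∑ᵇ-const k 1)) (∑ᵇ-const k _) ⟩
  2 ^ k * (2 ^ k * 1)                                     ∎
  where
  open ≤-Reasoning
  up down : Bits k → Bits k → ℕ
  up   s d = 𝟙[ e s < e (s ⊕ d) ]
  down s d = 𝟙[ e (s ⊕ d) < e s ]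
  T T′ : ℕ
  T  = ∑ᵇ (λ s → ∑ᵇ (up s))
  T′ = ∑ᵇ (λ s → ∑ᵇ (down s))
  translate : ∀ d → ∑ᵇ (λ s → up s d) ≡ ∑ᵇ (λ s → down s d)
  translate d = begin-equality
    ∑ᵇ (λ s → up s d)               ≡⟨ ∑ᵇ-⊕ (λ s → up s d) d ⟨
    ∑ᵇ (λ s → up (s ⊕ d) d)         ≡⟨ ∑ᵇ-cong (λ s → cong (λ t → 𝟙[ e (s ⊕ d) < e t ]) (⊕-cancelʳ s d)) ⟩
    ∑ᵇ (λ s → down s d)             ∎
  T≡T′ : T ≡ T′
  T≡T′ = trans (∑ᵇ-comm up) (trans (∑ᵇ-cong translate) (sym (∑ᵇ-comm down)))

∑-decode : ∀ k (f : Bits k → ℕ) → ∑ (λ q → f (decode {k} q)) ≡ ∑ᵇ f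
∑-decode k f = trans (∑-encode k (λ q → f (decode q))) (∑ᵇ-cong (λ s → cong f (decode-encode s)))

Agree : ∀ {k} → ℕ → Bits k → Bits k → Set
Agree zero    _       _       = ⊤
Agree (suc j) []      []      = ⊤
Agree (suc j) (x ∷ s) (y ∷ t) = x ≡ y × Agree j s t

Agree-suc⇒Agree : ∀ {k} j {s t : Bits k} → Agree (suc j) s t → Agree j s t
Agree-suc⇒Agree zero                    _         = tt
Agree-suc⇒Agree (suc j) {[]}    {[]}    _         = tt
Agree-suc⇒Agree (suc j) {_ ∷ _} {_ ∷ _} (x≡y , a) = x≡y , Agree-suc⇒Agree j a

Agree-⊕ : ∀ {k} j {s t : Bits k} (d : Bits k) → Agree j s t → Agree j (s ⊕ d) (t ⊕ d)
Agree-⊕ zero                    _       _          = tt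
Agree-⊕ (suc j) {[]}    {[]}    []      _          = tt
Agree-⊕ (suc j) {_ ∷ _} {_ ∷ _} (_ ∷ d) (refl , a) = refl , Agree-⊕ j d a

Agree-head : ∀ {k} j {s t : Bits (suc k)} → Agree (suc j) s t → head s ≡ head t
Agree-head j {_ ∷ _} {_ ∷ _} (x≡y , _) = x≡y

swapAt : ∀ {k} → ℕ → Bits k → Bits k
swapAt zero    (x ∷ y ∷ s) = y ∷ x ∷ s
swapAt (suc j) (x ∷ s)     = x ∷ swapAt j s
swapAt _       s           = s

swapAt-involutive : ∀ {k} j (s : Bits k) → swapAt j (swapAt j s) ≡ s
swapAt-involutive zero    []          = refl
swapAt-involutive zero    (x ∷ [])    = refl
swapAt-involutive zero    (x ∷ y ∷ s) = refl
swapAt-involutive (suc j) []          = refl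
swapAt-involutive (suc j) (x ∷ s)     = cong (x ∷_) (swapAt-involutive j s)

Agree-swapAt : ∀ {k} i j {s t : Bits k} → Agree (suc i) s t → Agree i (swapAt j s) (swapAt j t)
Agree-swapAt zero          _       _                                = tt
Agree-swapAt (suc i)       zero    {[]}        {[]}        _        = tt
Agree-swapAt (suc i)       zero    {_ ∷ []}    {_ ∷ []}    a        = Agree-suc⇒Agree (suc i) a
Agree-swapAt (suc zero)    zero    {_ ∷ _ ∷ _} {_ ∷ _ ∷ _} (_ , e , _) = e , tt
Agree-swapAt (suc (suc i)) zero    {_ ∷ _ ∷ _} {_ ∷ _ ∷ _} (e , e′ , a) = e′ , e , Agree-suc⇒Agree i a
Agree-swapAt (suc i)       (suc j) {[]}        {[]}        _        = tt
Agree-swapAt (suc i)       (suc j) {_ ∷ _}     {_ ∷ _}     (e , a)  = e , Agree-swapAt i j a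

swapAt-last : ∀ m (s : Bits (suc m)) → swapAt m s ≡ s
swapAt-last zero    (x ∷ []) = refl
swapAt-last (suc m) (x ∷ s)  = cong (x ∷_) (swapAt-last m s)

swapAt-0ᵇ : ∀ {k} j → swapAt j (0ᵇ {k}) ≡ 0ᵇ
swapAt-0ᵇ {zero}        zero    = refl
swapAt-0ᵇ {suc zero}    zero    = refl
swapAt-0ᵇ {suc (suc k)} zero    = refl
swapAt-0ᵇ {zero}        (suc j) = refl
swapAt-0ᵇ {suc k}       (suc j) = cong (false ∷_) (swapAt-0ᵇ j)

unitᵇ : ∀ {k} → ℕ → Bits k
unitᵇ {zero}  _       = []
unitᵇ {suc k} zero    = true ∷ 0ᵇ
unitᵇ {suc k} (suc j) = false ∷ unitᵇ j

swapAt-unitᵇ : ∀ {k} j → suc j < k → swapAt j (unitᵇ {k} (suc j)) ≡ unitᵇ j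
swapAt-unitᵇ {suc (suc k)} zero    _         = refl
swapAt-unitᵇ {suc k}       (suc j) (s≤s j<k) = cong (false ∷_) (swapAt-unitᵇ j j<k)

Agree-0ᵇ-unitᵇ : ∀ {k} j → Agree j (0ᵇ {k}) (unitᵇ j)
Agree-0ᵇ-unitᵇ          zero    = tt
Agree-0ᵇ-unitᵇ {zero}   (suc j) = tt
Agree-0ᵇ-unitᵇ {suc k}  (suc j) = refl , Agree-0ᵇ-unitᵇ j

twist : ∀ {k} → ℕ → Bits k → Bits k
twist zero    s = s
twist (suc j) s = swapAt j s

twist-involutive : ∀ {k} j (s : Bits k) → twist j (twist j s) ≡ s
twist-involutive zero    s = refl
twist-involutive (suc j) s = swapAt-involutive j s

Agree-twist : ∀ {k} i j {s t : Bits k} → Agree (suc i) s t → Agree i (twist j s) (twist j t)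
Agree-twist i zero    a = Agree-suc⇒Agree i a
Agree-twist i (suc j) a = Agree-swapAt i j a

prev : ∀ {n} → Fin (suc n) → Fin (suc n)
prev {n} zero = fromℕ n
prev (suc c)  = inject₁ c

next : ∀ {n} → Fin (suc n) → Fin (suc n)
next {zero}  zero    = zero
next {suc n} zero    = suc zero
next {suc n} (suc c) with next c
... | zero   = zero
... | suc c′ = suc (suc c′)

next-fromℕ : ∀ n → next (fromℕ n) ≡ zero
next-fromℕ zero                          = refl
next-fromℕ (suc n) rewrite next-fromℕ n = refl

next-inject₁ : ∀ {n} (c : Fin (suc n)) → next (inject₁ c) ≡ suc c
next-inject₁ zero                                  = refl
next-inject₁ {suc n} (suc c) rewrite next-inject₁ c = refl

next-prev : ∀ {n} (c : Fin (suc n)) → next (prev c) ≡ c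
next-prev {n} zero       = next-fromℕ n
next-prev {suc n} (suc c) = next-inject₁ c

prev-next : ∀ {n} (c : Fin (suc n)) → prev (next c) ≡ c
prev-next {zero}  zero    = refl
prev-next {suc n} zero    = refl
prev-next {suc n} (suc c) with next c | prev-next c
... | zero   | eq = cong suc eq
... | suc c′ | eq = cong suc eq

prev≢id : ∀ {n} (c : Fin (suc (suc n))) → prev c ≢ c
prev≢id {n} zero eq = 0≢1+n (trans (sym (cong toℕ eq)) (toℕ-fromℕ (suc n)))
prev≢id (suc c) eq  = 1+n≢n (trans (sym (cong toℕ eq)) (toℕ-inject₁ c))

next≢id : ∀ {n} (c : Fin (suc (suc n))) → next c ≢ c
next≢id c eq = prev≢id c (trans (cong prev (sym eq)) (prev-next c))

prev²≢id : ∀ {n} (c : Fin (suc (suc (suc n)))) → prev (prev c) ≢ c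
prev²≢id {n} zero eq          = 0≢1+n (trans (sym (cong toℕ eq)) (trans (toℕ-inject₁ (fromℕ (suc n))) (toℕ-fromℕ (suc n))))
prev²≢id {n} (suc zero) eq    = 0≢1+n (suc-injective (trans (sym (cong toℕ eq)) (toℕ-fromℕ (suc (suc n)))))
prev²≢id (suc (suc c)) eq     =
  m≢1+n+m (toℕ c) {1} (trans (sym (trans (toℕ-inject₁ (inject₁ c)) (toℕ-inject₁ c))) (cong toℕ eq))

next≢prev : ∀ {n} (c : Fin (suc (suc (suc n)))) → next c ≢ prev c
next≢prev c eq = prev²≢id c (trans (cong prev (sym eq)) (prev-next c))

next≡zero⇒≡fromℕ : ∀ {n} (c : Fin (suc n)) → next c ≡ zero → c ≡ fromℕ n
next≡zero⇒≡fromℕ c eq = trans (sym (prev-next c)) (cong prev eq)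

-- Port graphs on an arbitrary node type

record PortGraphOn (X : Set) : Set where
  field
    degree              : X → ℕ
    neighbour           : (x : X) → Fin (degree x) → X
    arrival             : (x : X) (p : Fin (degree x)) → Fin (degree (neighbour x p))
    arrival-back        : ∀ x p → neighbour (neighbour x p) (arrival x p) ≡ x
    neighbour≢          : ∀ x p → neighbour x p ≢ x
    neighbour-injective : ∀ x → Injective _≡_ _≡_ (neighbour x)

tabulate-cong-toℕ : ∀ {A : Set} {m n} {f : Fin m → A} {g : Fin n → A} → m ≡ n →
  (∀ p q → toℕ p ≡ toℕ q → f p ≡ g q) → tabulate f ≡ tabulate g
tabulate-cong-toℕ refl f≈g = tabulate-cong (λ p → f≈g p p refl)

module _ {X : Set} (H : PortGraphOn X) where
  open PortGraphOn H

  viewOn : ℕ → X → Tree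
  viewOn zero    x = node []
  viewOn (suc k) x = node (tabulate λ p → suc (toℕ p) , suc (toℕ (arrival x p)) , viewOn k (neighbour x p))

  -- Ports of x and y are matched by number: degree x ≡ degree y need not hold definitionally.
  IsGradedBisimulation : (ℕ → X → X → Set) → Set
  IsGradedBisimulation R = ∀ k x y → R (suc k) x y →
    degree x ≡ degree y ×
    (∀ p q → toℕ p ≡ toℕ q → toℕ (arrival x p) ≡ toℕ (arrival y q) × R k (neighbour x p) (neighbour y q))

  viewOn-bisimulation : ∀ {R} → IsGradedBisimulation R → ∀ k x y → R k x y → viewOn k x ≡ viewOn k y
  viewOn-bisimulation     bisim zero    x y _   = refl
  viewOn-bisimulation {R} bisim (suc k) x y xRy with bisim k x y xRy
  ... | deg≡ , nbrs = cong node (tabulate-cong-toℕ deg≡ λ p q p≡q →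
    cong₂ _,_ (cong suc p≡q) (cong₂ _,_ (cong suc (proj₁ (nbrs p q p≡q)))
      (viewOn-bisimulation {R} bisim k _ _ (proj₂ (nbrs p q p≡q)))))

  data WalkOn : ℕ → X → X → Set where
    here : ∀ {x} → WalkOn zero x x
    step : ∀ {k x y} (p : Fin (degree x)) → WalkOn k (neighbour x p) y → WalkOn (suc k) x y

  _++ʷ_ : ∀ {i j x y z} → WalkOn i x y → WalkOn j y z → WalkOn (i + j) x z
  here     ++ʷ w′ = w′
  step p w ++ʷ w′ = step p (w ++ʷ w′)

  WalkWithin : ℕ → X → X → Set
  WalkWithin d x y = ∃ λ k → k ≤ d × WalkOn k x y

  walkWithin-++ : ∀ {i j x y z} → WalkWithin i x y → WalkWithin j y z → WalkWithin (i + j) x z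
  walkWithin-++ (k , k≤i , w) (k′ , k′≤j , w′) = k + k′ , +-mono-≤ k≤i k′≤j , w ++ʷ w′

  walkWithin-refl : ∀ {d x} → WalkWithin d x x
  walkWithin-refl = zero , z≤n , here

  walkWithin-step : ∀ {x y} p → neighbour x p ≡ y → WalkWithin 1 x y
  walkWithin-step p refl = 1 , ≤-refl , step p here

-- The summand of countUp is local to Defs; `summands` recovers it from the unfolding of countUp.
summands : ∀ {k} {f : Fin k → ℕ} (x : ℕ) → x ≡ ∑ f → Fin k → ℕ
summands {f = f} _ _ = f

countUp-𝟙< : ∀ {n} (G : PortGraph n) u → countUp G u ≡ ∑ (λ p → 𝟙[ toℕ u < toℕ (nbr G u p) ])
countUp-𝟙< G u = ∑-cong pointwise
  where
  pointwise : ∀ p → summands (countUp G u) refl p ≡ 𝟙[ toℕ u < toℕ (nbr G u p) ]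
  pointwise p with toℕ u <? toℕ (nbr G u p)
  ... | yes _ = refl
  ... | no  _ = refl

module Relabel {X : Set} (H : PortGraphOn X) {n} (ι : Fin n ↔ X) where
  open PortGraphOn H
  open Inverse ι using (to; from) renaming (strictlyInverseˡ to to∘from; strictlyInverseʳ to from∘to)

  transport-port : ∀ {x y} → x ≡ y → Fin (degree y) → Fin (degree x)
  transport-port x≡y = cast (cong degree (sym x≡y))

  neighbour-transport : ∀ {x y} (x≡y : x ≡ y) q → neighbour x (transport-port x≡y q) ≡ neighbour y q
  neighbour-transport {x} refl q = cong (neighbour x) (cast-is-id _ q)

  graph : PortGraph n
  graph = record
    { deg      = λ u → degree (to u)
    ; nbr      = λ u p → from (neighbour (to u) p)
    ; rev      = λ u p → transport-port (to∘from (neighbour (to u) p)) (arrival (to u) p)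
    ; rev-back = λ u p → trans (cong from (trans (neighbour-transport (to∘from _) _) (arrival-back (to u) p)))
                               (from∘to u)
    ; no-loop  = λ u p eq → neighbour≢ (to u) p (trans (sym (to∘from _)) (cong to eq))
    ; no-multi = λ u eq → neighbour-injective (to u) (trans (sym (to∘from _)) (trans (cong to eq) (to∘from _)))
    }

  view-graph : ∀ k u → view graph k u ≡ viewOn H k (to u)
  view-graph zero    u = refl
  view-graph (suc k) u = cong node (tabulate-cong λ p →
    cong₂ _,_ refl (cong₂ _,_ (cong suc (toℕ-cast _ (arrival (to u) p)))
      (trans (view-graph k _) (cong (viewOn H k) (to∘from _)))))

  view-graph-from : ∀ k x → view graph k (from x) ≡ viewOn H k x
  view-graph-from k x = trans (view-graph k (from x)) (cong (viewOn H k) (to∘from x))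

  walk-graph : ∀ {k x y} u → to u ≡ x → WalkOn H k x y → Walk graph k u (from y)
  walk-graph u refl here       = subst (λ v → Walk graph zero u v) (sym (from∘to u)) here
  walk-graph u refl (step p w) = step p (walk-graph _ (to∘from _) w)

  diameter-graph : ∀ d → (∀ x y → WalkWithin H d x y) → DiameterAtMost graph d
  diameter-graph d walks u v with walks (to u) (to v)
  ... | k , k≤d , w = k , k≤d , subst (Walk graph k u) (from∘to v) (walk-graph u refl w)

  countUp-graph : ∀ x → countUp graph (from x) ≡ ∑ (λ p → 𝟙[ toℕ (from x) < toℕ (from (neighbour x p)) ])
  countUp-graph x = trans (countUp-𝟙< graph (from x)) (relocate (to∘from x))
    where
    relocate : ∀ {y} → to (from x) ≡ y →
      ∑ (λ p → 𝟙[ toℕ (from x) < toℕ (from (neighbour (to (from x)) p)) ]) ≡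
      ∑ (λ p → 𝟙[ toℕ (from x) < toℕ (from (neighbour y p)) ])
    relocate refl = refl

DiameterAtMost⇒Connected : ∀ {n} (G : PortGraph n) d → DiameterAtMost G d → Connected G
DiameterAtMost⇒Connected G d diam u v with diam u v
... | k , _ , w = k , w

-- The construction

mirror : Bool → Fin 3 → Fin 3
mirror false p                = p
mirror true  zero             = suc (suc zero)
mirror true  (suc zero)       = suc zero
mirror true  (suc (suc zero)) = zero

mirror-involutive : ∀ b p → mirror b (mirror b p) ≡ p
mirror-involutive false p                = refl
mirror-involutive true  zero             = refl
mirror-involutive true  (suc zero)       = refl
mirror-involutive true  (suc (suc zero)) = refl

mirror-injective : ∀ b → Injective _≡_ _≡_ (mirror b)
mirror-injective b {p} {p′} eq =
  trans (sym (mirror-involutive b p)) (trans (cong (mirror b) eq) (mirror-involutive b p′))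

mirror-middle : ∀ b → mirror b (suc zero) ≡ suc zero
mirror-middle false = refl
mirror-middle true  = refl

bubble : ∀ {k} → ℕ → Bits k → Bits k
bubble zero    s = s
bubble (suc j) s = bubble j (swapAt j s)

bubble-0ᵇ : ∀ {k} j → bubble j (0ᵇ {k}) ≡ 0ᵇ
bubble-0ᵇ zero    = refl
bubble-0ᵇ (suc j) = trans (cong (bubble j) (swapAt-0ᵇ j)) (bubble-0ᵇ j)

bubble-unitᵇ : ∀ {k} j → j < k → bubble j (unitᵇ {k} j) ≡ unitᵇ 0
bubble-unitᵇ zero    _   = refl
bubble-unitᵇ (suc j) j<k =
  trans (cong (bubble j) (swapAt-unitᵇ j j<k)) (bubble-unitᵇ j (<-trans (n<1+n j) j<k))

-- Follows port 1 for j steps and reads the port at which the next port-1 edge arrives (0 if too shallow).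
firstPortArrival : ℕ → Tree → ℕ
firstPortArrival _       (node [])                = 0
firstPortArrival zero    (node ((_ , r , _) ∷ _)) = r
firstPortArrival (suc j) (node ((_ , _ , t) ∷ _)) = firstPortArrival j t

t+p[1+k]+[1+k]3p≤p*p : ∀ t p k → 2 * t ≤ p * (p * 1) → 8 * suc k ≤ p →
  t + p * (1 + k * 1) + suc k * (p * 3) ≤ p * p
t+p[1+k]+[1+k]3p≤p*p t p k 2t≤p² 8[1+k]≤p = *-cancelˡ-≤ 2 (begin
  2 * (t + p * (1 + k * 1) + suc k * (p * 3)) ≡⟨ lhs-form t p k ⟩
  2 * t + (8 * suc k) * p                     ≤⟨ +-mono-≤ 2t≤p² (*-monoˡ-≤ p 8[1+k]≤p) ⟩
  p * (p * 1) + p * p                         ≡⟨ rhs-form p ⟩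
  2 * (p * p)                                 ∎)
  where
  open ≤-Reasoning
  open +-*-Solver
  lhs-form : ∀ t p k → 2 * (t + p * (1 + k * 1) + suc k * (p * 3)) ≡ 2 * t + (8 * suc k) * p
  lhs-form = solve 3 (λ t p k → con 2 :* (t :+ p :* (con 1 :+ k :* con 1) :+ (con 1 :+ k) :* (p :* con 3))
                                := con 2 :* t :+ (con 8 :* (con 1 :+ k)) :* p) refl
  rhs-form : ∀ p → p * (p * 1) + p * p ≡ 2 * (p * p)
  rhs-form = solve 1 (λ p → p :* (p :* con 1) :+ p :* p := con 2 :* (p :* p)) refl

SeparatingGraph : ℕ → ℕ → Set
SeparatingGraph l N = Σ (PortGraph N) λ G →
  Connected G × numEdges G ≤ 2 ^ (2 * l) × DiameterAtMost G 3 ×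
  Σ (Fin N) λ a → Σ (Fin N) λ b → ¬ SameView G a b × view G (l ∸ 1) a ≡ view G (l ∸ 1) b

module Construction (m : ℕ) where

  -- With at least three ring positions, the two ring neighbours of a node are distinct.
  l : ℕ
  l = 2 + m

  P : ℕ
  P = 2 ^ l

  data Node : Set where
    hub  : Bits l → Node
    ring : Fin (suc l) → Bits l → Node

  code : Node → Bits l
  code (hub s)    = s
  code (ring _ s) = s

  degree : Node → ℕ
  degree (hub _)    = P + l
  degree (ring _ _) = 3

  -- The only place where a code becomes visible in a view.
  twisted : Fin (suc l) → Bits l → Bool
  twisted zero    s = head s
  twisted (suc _) s = false

  ringNeighbour : Fin (suc l) → Bits l → Fin 3 → Node
  ringNeighbour c s zero             = ring (prev c) (twist (toℕ (prev c)) s)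
  ringNeighbour c s (suc zero)       = hub s
  ringNeighbour c s (suc (suc zero)) = ring (next c) (twist (toℕ c) s)

  difference : Fin P → Bits l
  difference = decode

  differenceNeighbour : Bool → Bits l → Bits l → Node
  differenceNeighbour true  s d = ring zero s
  differenceNeighbour false s d = hub (s ⊕ d)

  hubNeighbour : Bits l → Fin P ⊎ Fin l → Node
  hubNeighbour s (inj₁ q) = differenceNeighbour (isZero (difference q)) s (difference q)
  hubNeighbour s (inj₂ j) = ring (suc j) s

  neighbour : (x : Node) → Fin (degree x) → Node
  neighbour (hub s)    p = hubNeighbour s (splitAt P p)
  neighbour (ring c s) p = ringNeighbour c s (mirror (twisted c s) p)

  hubPort : Fin (suc l) → Fin (P + l)
  hubPort zero    = encode (0ᵇ {l}) ↑ˡ l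
  hubPort (suc j) = P ↑ʳ j

  ringArrival : ∀ c s (r : Fin 3) → Fin (degree (ringNeighbour c s r))
  ringArrival c s zero             = mirror (twisted (prev c) (twist (toℕ (prev c)) s)) (suc (suc zero))
  ringArrival c s (suc zero)       = hubPort c
  ringArrival c s (suc (suc zero)) = mirror (twisted (next c) (twist (toℕ c) s)) zero

  differenceArrival : ∀ b s d (q : Fin P) → Fin (degree (differenceNeighbour b s d))
  differenceArrival true  s d q = suc zero
  differenceArrival false s d q = q ↑ˡ l

  hubArrival : ∀ s (z : Fin P ⊎ Fin l) → Fin (degree (hubNeighbour s z))
  hubArrival s (inj₁ q) = differenceArrival (isZero (difference q)) s (difference q) q
  hubArrival s (inj₂ j) = suc zero

  arrival : (x : Node) (p : Fin (degree x)) → Fin (degree (neighbour x p))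
  arrival (hub s)    p = hubArrival s (splitAt P p)
  arrival (ring c s) p = ringArrival c s (mirror (twisted c s) p)

  neighbour-hub-encode : ∀ s d → neighbour (hub s) (encode d ↑ˡ l) ≡ differenceNeighbour (isZero d) s d
  neighbour-hub-encode s d = trans (cong (hubNeighbour s) (splitAt-↑ˡ P (encode d) l))
                                   (cong (λ d′ → differenceNeighbour (isZero d′) s d′) (decode-encode d))

  neighbour-hubPort : ∀ c s → neighbour (hub s) (hubPort c) ≡ ring c s
  neighbour-hubPort zero    s = trans (neighbour-hub-encode s 0ᵇ) (cong (λ b → differenceNeighbour b s 0ᵇ) (isZero-0ᵇ l))
  neighbour-hubPort (suc j) s = cong (hubNeighbour s) (splitAt-↑ʳ P l j)

  neighbour-ring-middle : ∀ c s → neighbour (ring c s) (suc zero) ≡ hub s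
  neighbour-ring-middle c s rewrite mirror-middle (twisted c s) = refl

  ringArrival-back : ∀ c s r → neighbour (ringNeighbour c s r) (ringArrival c s r) ≡ ring c s
  ringArrival-back c s zero
    rewrite mirror-involutive (twisted (prev c) (twist (toℕ (prev c)) s)) (suc (suc zero))
          | next-prev c | twist-involutive (toℕ (prev c)) s = refl
  ringArrival-back c s (suc zero) = neighbour-hubPort c s
  ringArrival-back c s (suc (suc zero))
    rewrite mirror-involutive (twisted (next c) (twist (toℕ c) s)) zero
          | prev-next c | twist-involutive (toℕ c) s = refl

  differenceArrival-back : ∀ b s (q : Fin P) → isZero (difference q) ≡ b →
    neighbour (differenceNeighbour b s (difference q)) (differenceArrival b s (difference q) q) ≡ hub s
  differenceArrival-back true  s q _ = neighbour-ring-middle zero s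
  differenceArrival-back false s q z rewrite splitAt-↑ˡ P q l | z = cong hub (⊕-cancelʳ s (difference q))

  arrival-back : ∀ x p → neighbour (neighbour x p) (arrival x p) ≡ x
  arrival-back (hub s) p with splitAt P p
  ... | inj₁ q = differenceArrival-back (isZero (difference q)) s q refl
  ... | inj₂ j = neighbour-ring-middle (suc j) s
  arrival-back (ring c s) p = ringArrival-back c s (mirror (twisted c s) p)

  hub-injective : ∀ {s t} → hub s ≡ hub t → s ≡ t
  hub-injective refl = refl

  ring-injectiveˡ : ∀ {c c′ s t} → ring c s ≡ ring c′ t → c ≡ c′
  ring-injectiveˡ refl = refl

  ringNeighbour≢ : ∀ c s r → ringNeighbour c s r ≢ ring c s
  ringNeighbour≢ c s zero             eq = prev≢id c (ring-injectiveˡ eq)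
  ringNeighbour≢ c s (suc (suc zero)) eq = next≢id c (ring-injectiveˡ eq)

  differenceNeighbour≢ : ∀ b s d → isZero d ≡ b → differenceNeighbour b s d ≢ hub s
  differenceNeighbour≢ false s d isZero≡false eq =
    not-¬ refl (trans (sym (trans (cong isZero d≡0ᵇ) (isZero-0ᵇ l))) isZero≡false)
    where
    d≡0ᵇ : d ≡ 0ᵇ
    d≡0ᵇ = ⊕-injectiveˡ s (trans (hub-injective eq) (sym (⊕-identityʳ s)))

  neighbour≢ : ∀ x p → neighbour x p ≢ x
  neighbour≢ (hub s) p with splitAt P p
  ... | inj₁ q = differenceNeighbour≢ (isZero (difference q)) s (difference q) refl
  ... | inj₂ j = λ ()
  neighbour≢ (ring c s) p = ringNeighbour≢ c s (mirror (twisted c s) p)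

  ringNeighbour-injective : ∀ c s → Injective _≡_ _≡_ (ringNeighbour c s)
  ringNeighbour-injective c s {zero}             {zero}             _  = refl
  ringNeighbour-injective c s {zero}             {suc (suc zero)}   eq = ⊥-elim (next≢prev c (sym (ring-injectiveˡ eq)))
  ringNeighbour-injective c s {suc zero}         {suc zero}         _  = refl
  ringNeighbour-injective c s {suc zero}         {suc (suc zero)}   ()
  ringNeighbour-injective c s {suc (suc zero)}   {zero}             eq = ⊥-elim (next≢prev c (ring-injectiveˡ eq))
  ringNeighbour-injective c s {suc (suc zero)}   {suc (suc zero)}   _  = refl

  differenceNeighbour-injective : ∀ {b b′} s {d d′} → isZero d ≡ b → isZero d′ ≡ b′ →
    differenceNeighbour b s d ≡ differenceNeighbour b′ s d′ → d ≡ d′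
  differenceNeighbour-injective {true}  {true}  s {d} {d′} z z′ _  = trans (isZero⇒≡0ᵇ d z) (sym (isZero⇒≡0ᵇ d′ z′))
  differenceNeighbour-injective {false} {false} s          _ _  eq = ⊕-injectiveˡ s (hub-injective eq)

  differenceNeighbour≢ring-suc : ∀ b s d j → differenceNeighbour b s d ≢ ring (suc j) s
  differenceNeighbour≢ring-suc true s d j eq with ring-injectiveˡ eq
  ... | ()

  hubNeighbour-injective : ∀ s → Injective _≡_ _≡_ (hubNeighbour s)
  hubNeighbour-injective s {inj₁ q} {inj₁ q′} eq =
    cong inj₁ (decode-injective {l} (differenceNeighbour-injective s refl refl eq))
  hubNeighbour-injective s {inj₁ q} {inj₂ j}  eq = ⊥-elim (differenceNeighbour≢ring-suc _ s _ j eq)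
  hubNeighbour-injective s {inj₂ j} {inj₁ q}  eq = ⊥-elim (differenceNeighbour≢ring-suc _ s _ j (sym eq))
  hubNeighbour-injective s {inj₂ j} {inj₂ j′} eq = cong inj₂ (Fin-suc-injective (ring-injectiveˡ eq))

  neighbour-injective : ∀ x → Injective _≡_ _≡_ (neighbour x)
  neighbour-injective (hub s) {p} {p′} eq = begin
    p                       ≡⟨ join-splitAt P l p ⟨
    join P l (splitAt P p)  ≡⟨ cong (join P l) (hubNeighbour-injective s {splitAt P p} {splitAt P p′} eq) ⟩
    join P l (splitAt P p′) ≡⟨ join-splitAt P l p′ ⟩
    p′                      ∎
    where open ≡-Reasoning
  neighbour-injective (ring c s) eq = mirror-injective (twisted c s) (ringNeighbour-injective c s eq)

  portGraph : PortGraphOn Node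
  portGraph = record
    { degree              = degree
    ; neighbour           = neighbour
    ; arrival             = arrival
    ; arrival-back        = arrival-back
    ; neighbour≢          = neighbour≢
    ; neighbour-injective = neighbour-injective
    }

  n : ℕ
  n = suc (suc l) * P

  level : Node → Fin (suc (suc l))
  level (hub _)    = zero
  level (ring c _) = suc c

  atLevel : Fin (suc (suc l)) → Bits l → Node
  atLevel zero    s = hub s
  atLevel (suc c) s = ring c s

  atLevel-level : ∀ x → atLevel (level x) (code x) ≡ x
  atLevel-level (hub _)    = refl
  atLevel-level (ring _ _) = refl

  index : Node → Fin n
  index x = combine (level x) (encode (code x))

  index-atLevel : ∀ c s → index (atLevel c s) ≡ combine c (encode s)
  index-atLevel zero    s = refl
  index-atLevel (suc c) s = refl

  nodeAt : Fin n → Node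
  nodeAt u = atLevel (proj₁ (remQuot {suc (suc l)} P u)) (difference (proj₂ (remQuot {suc (suc l)} P u)))

  nodeAt-index : ∀ x → nodeAt (index x) ≡ x
  nodeAt-index x = begin
    nodeAt (index x)
      ≡⟨ cong (λ (cq : Fin (suc (suc l)) × Fin P) → atLevel (proj₁ cq) (difference (proj₂ cq)))
              (remQuot-combine (level x) (encode (code x))) ⟩
    atLevel (level x) (difference (encode (code x)))
      ≡⟨ cong (atLevel (level x)) (decode-encode (code x)) ⟩
    atLevel (level x) (code x)
      ≡⟨ atLevel-level x ⟩
    x ∎
    where open ≡-Reasoning

  index-nodeAt : ∀ u → index (nodeAt u) ≡ u
  index-nodeAt u = begin
    index (atLevel c (difference q)) ≡⟨ index-atLevel c (difference q) ⟩
    combine c (encode (difference q)) ≡⟨ cong (combine c) (encode-decode {l} q) ⟩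
    combine c q                       ≡⟨ combine-remQuot {suc (suc l)} P u ⟩
    u                                 ∎
    where
    open ≡-Reasoning
    c : Fin (suc (suc l))
    c = proj₁ (remQuot {suc (suc l)} P u)
    q : Fin P
    q = proj₂ (remQuot {suc (suc l)} P u)

  indexing : Fin n ↔ Node
  indexing = mk↔ₛ′ nodeAt index nodeAt-index index-nodeAt

  open Relabel portGraph indexing using (graph; view-graph-from; diameter-graph; countUp-graph)

  Similar : ℕ → Node → Node → Set
  Similar k (hub s)    (hub t)     = Agree k s t
  Similar k (ring c s) (ring c′ t) = c ≡ c′ × Agree k s t
  Similar k _          _           = ⊥

  twisted-cong : ∀ c {s t} → head s ≡ head t → twisted c s ≡ twisted c t
  twisted-cong zero    h = h
  twisted-cong (suc _) _ = refl

  twisted-twist : ∀ c {s t} → head s ≡ head t → twisted c (twist (toℕ c) s) ≡ twisted c (twist (toℕ c) t)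
  twisted-twist zero    h = h
  twisted-twist (suc _) _ = refl

  twist-last : ∀ s → twist (toℕ (fromℕ l)) s ≡ s
  twist-last s = trans (cong (λ j → twist j s) (toℕ-fromℕ l)) (swapAt-last (suc m) s)

  twisted-next-twist : ∀ c {s t} → head s ≡ head t →
    twisted (next c) (twist (toℕ c) s) ≡ twisted (next c) (twist (toℕ c) t)
  twisted-next-twist c {s} {t} h with next c in eq
  ... | suc _ = refl
  ... | zero rewrite next≡zero⇒≡fromℕ c eq = trans (cong head (twist-last s)) (trans h (cong head (sym (twist-last t))))

  ringStep : ∀ k c {s t} → Agree (suc k) s t → ∀ r →
    toℕ (ringArrival c s r) ≡ toℕ (ringArrival c t r) × Similar k (ringNeighbour c s r) (ringNeighbour c t r)
  ringStep k c a zero =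
    cong (λ b → toℕ (mirror b (suc (suc zero)))) (twisted-twist (prev c) (Agree-head k a)) ,
    refl , Agree-twist k (toℕ (prev c)) a
  ringStep k c a (suc zero) = refl , Agree-suc⇒Agree k a
  ringStep k c a (suc (suc zero)) =
    cong (λ b → toℕ (mirror b zero)) (twisted-next-twist c (Agree-head k a)) ,
    refl , Agree-twist k (toℕ c) a

  hubStep : ∀ k {s t} → Agree (suc k) s t → ∀ z →
    toℕ (hubArrival s z) ≡ toℕ (hubArrival t z) × Similar k (hubNeighbour s z) (hubNeighbour t z)
  hubStep k a (inj₁ q) with isZero (difference q)
  ... | true  = refl , refl , Agree-suc⇒Agree k a
  ... | false = refl , Agree-⊕ k (difference q) (Agree-suc⇒Agree k a)
  hubStep k a (inj₂ j) = refl , refl , Agree-suc⇒Agree k a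

  similar-isGradedBisimulation : IsGradedBisimulation portGraph Similar
  similar-isGradedBisimulation k (hub s) (hub t) a = refl , λ p q p≡q → samePort p q p≡q
    where
    samePort : ∀ p q → toℕ p ≡ toℕ q →
      toℕ (arrival (hub s) p) ≡ toℕ (arrival (hub t) q) × Similar k (neighbour (hub s) p) (neighbour (hub t) q)
    samePort p q p≡q with toℕ-injective p≡q
    ... | refl = hubStep k a (splitAt P p)
  similar-isGradedBisimulation k (ring c s) (ring c t) (refl , a) = refl , samePort
    where
    samePort : ∀ p q → toℕ p ≡ toℕ q →
      toℕ (arrival (ring c s) p) ≡ toℕ (arrival (ring c t) q) × Similar k (neighbour (ring c s) p) (neighbour (ring c t) q)
    samePort p q p≡q with toℕ-injective p≡q
    ... | refl rewrite twisted-cong c {s} {t} (Agree-head k a) = ringStep k c a (mirror (twisted c t) p)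

  headArrival : Bits l → ℕ
  headArrival s = suc (toℕ (mirror (head s) (suc (suc zero))))

  -- Walking from ring position c + 1 down to 0 through port 1 bubbles bit c of the code to the front,
  -- where it decides the port by which the walk enters position 0.
  firstPortArrival-ring : ∀ j c s → toℕ c ≡ j →
    firstPortArrival j (viewOn portGraph (suc j) (ring (suc c) s)) ≡ headArrival (bubble j s)
  firstPortArrival-ring zero    zero    s _ = refl
  firstPortArrival-ring (suc j) (suc c) s c≡j =
    trans (firstPortArrival-ring j (inject₁ c) (swapAt (toℕ (inject₁ c)) s) inject₁c≡j)
          (cong (λ i → headArrival (bubble j (swapAt i s))) inject₁c≡j)
    where
    inject₁c≡j : toℕ (inject₁ c) ≡ j
    inject₁c≡j = trans (toℕ-inject₁ c) (suc-injective c≡j)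

  a b : Node
  a = ring (fromℕ l) 0ᵇ
  b = ring (fromℕ l) (unitᵇ (suc m))

  a≁b : viewOn portGraph l a ≢ viewOn portGraph l b
  a≁b eq = 3≢1 (begin
    3                                                           ≡⟨ cong headArrival (bubble-0ᵇ (suc m)) ⟨
    headArrival (bubble (suc m) 0ᵇ)                             ≡⟨ firstPortArrival-ring (suc m) _ 0ᵇ (toℕ-fromℕ (suc m)) ⟨
    firstPortArrival (suc m) (viewOn portGraph l a)             ≡⟨ cong (firstPortArrival (suc m)) eq ⟩
    firstPortArrival (suc m) (viewOn portGraph l b)             ≡⟨ firstPortArrival-ring (suc m) _ _ (toℕ-fromℕ (suc m)) ⟩
    headArrival (bubble (suc m) (unitᵇ (suc m)))                ≡⟨ cong headArrival (bubble-unitᵇ (suc m) (n<1+n (suc m))) ⟩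
    1                                                           ∎)
    where
    open ≡-Reasoning
    3≢1 : 3 ≢ 1
    3≢1 ()

  toHub : ∀ x → WalkWithin portGraph 1 x (hub (code x))
  toHub (hub _)    = walkWithin-refl portGraph
  toHub (ring c s) = walkWithin-step portGraph (suc zero) (neighbour-ring-middle c s)

  fromHub : ∀ y → WalkWithin portGraph 1 (hub (code y)) y
  fromHub (hub _)    = walkWithin-refl portGraph
  fromHub (ring c t) = walkWithin-step portGraph (hubPort c) (neighbour-hubPort c t)

  hubToHub : ∀ s t → WalkWithin portGraph 1 (hub s) (hub t)
  hubToHub s t with isZero (s ⊕ t) in z
  ... | true rewrite ⊕≡0ᵇ⇒≡ (isZero⇒≡0ᵇ (s ⊕ t) z) = walkWithin-refl portGraph
  ... | false = walkWithin-step portGraph (encode (s ⊕ t) ↑ˡ l) (begin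
    neighbour (hub s) (encode (s ⊕ t) ↑ˡ l)          ≡⟨ neighbour-hub-encode s (s ⊕ t) ⟩
    differenceNeighbour (isZero (s ⊕ t)) s (s ⊕ t)  ≡⟨ cong (λ b → differenceNeighbour b s (s ⊕ t)) z ⟩
    hub (s ⊕ (s ⊕ t))                               ≡⟨ cong hub (⊕-cancelˡ s t) ⟩
    hub t                                           ∎)
    where open ≡-Reasoning

  walkWithin-3 : ∀ x y → WalkWithin portGraph 3 x y
  walkWithin-3 x y =
    walkWithin-++ portGraph (toHub x) (walkWithin-++ portGraph (hubToHub (code x) (code y)) (fromHub y))

  ∑-nodes : (f : Fin n → ℕ) →
    ∑ f ≡ ∑ᵇ (λ s → f (index (hub s))) + ∑ {suc l} (λ c → ∑ᵇ (λ s → f (index (ring c s))))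
  ∑-nodes f = trans (∑-combine (suc (suc l)) {P} f)
                    (cong₂ _+_ (∑-encode l (λ q → f (combine {suc (suc l)} zero q)))
                               (∑-cong {suc l} (λ c → ∑-encode l (λ q → f (combine {suc (suc l)} (suc c) q)))))

  countUp-ring : ∀ c s → countUp graph (index (ring c s)) ≤ 3
  countUp-ring c s = ≤-trans (≤-reflexive (countUp-graph (ring c s))) (∑-≤-* 1 (λ p → 𝟙<-≤1 (toℕ (index (ring c s))) (toℕ (index (neighbour (ring c s) p)))))

  hubIndex : Bits l → ℕ
  hubIndex s = toℕ (index (hub s))

  countUp-hub : ∀ s → countUp graph (index (hub s)) ≤ (∑ᵇ (λ d → 𝟙[ hubIndex s < hubIndex (s ⊕ d) ]) + 1) + l * 1
  countUp-hub s = begin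
    countUp graph (index (hub s))                 ≡⟨ countUp-graph (hub s) ⟩
    ∑ {P + l} above                               ≡⟨ ∑-↑ P above ⟩
    ∑ (λ q → above (q ↑ˡ l)) + ∑ (λ j → above (P ↑ʳ j))
      ≤⟨ +-mono-≤ (≤-reflexive (∑-cong (λ q → cong (aboveVia ∘ hubNeighbour s) (splitAt-↑ˡ P q l))))
                  (∑-≤-* 1 (λ j → 𝟙<-≤1 (hubIndex s) (toℕ (index (neighbour (hub s) (P ↑ʳ j)))))) ⟩
    ∑ (λ q → aboveDifference (difference q)) + l * 1 ≡⟨ cong (_+ l * 1) (∑-decode l aboveDifference) ⟩
    ∑ᵇ aboveDifference + l * 1                    ≤⟨ +-monoˡ-≤ (l * 1) (∑ᵇ-mono-≤ aboveDifference≤) ⟩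
    ∑ᵇ (λ d → up d + zeroIndicator d) + l * 1     ≡⟨ cong (_+ l * 1) (∑ᵇ-distrib-+ up zeroIndicator) ⟩
    ∑ᵇ up + ∑ᵇ zeroIndicator + l * 1             ≡⟨ cong (λ z → ∑ᵇ up + z + l * 1) (∑ᵇ-isZero l) ⟩
    ∑ᵇ up + 1 + l * 1                             ∎
    where
    open ≤-Reasoning
    aboveVia : Node → ℕ
    aboveVia y = 𝟙[ hubIndex s < toℕ (index y) ]
    above : Fin (P + l) → ℕ
    above p = aboveVia (neighbour (hub s) p)
    aboveDifference : Bits l → ℕ
    aboveDifference d = aboveVia (differenceNeighbour (isZero d) s d)
    up zeroIndicator : Bits l → ℕ
    up d = 𝟙[ hubIndex s < hubIndex (s ⊕ d) ]
    zeroIndicator d = if isZero d then 1 else 0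
    aboveDifference≤ : ∀ d → aboveDifference d ≤ up d + zeroIndicator d
    aboveDifference≤ d with isZero d
    ... | true  = ≤-trans (𝟙<-≤1 (hubIndex s) (toℕ (index (ring zero s)))) (m≤n+m 1 (up d))
    ... | false = ≤-reflexive (sym (+-identityʳ (up d)))

  numEdges≤ : 8 * suc l ≤ P → numEdges graph ≤ 2 ^ (2 * l)
  numEdges≤ 8[1+l]≤P = begin
    numEdges graph
      ≡⟨ ∑-nodes (countUp graph) ⟩
    ∑ᵇ (λ s → countUp graph (index (hub s))) + ∑ {suc l} (λ c → ∑ᵇ (λ s → countUp graph (index (ring c s))))
      ≤⟨ +-mono-≤ (∑ᵇ-mono-≤ countUp-hub)
                  (∑-≤-* (P * 3) (λ c → ≤-trans (∑ᵇ-mono-≤ (countUp-ring c)) (≤-reflexive (∑ᵇ-const l 3)))) ⟩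
    ∑ᵇ (λ s → (U s + 1) + l * 1) + suc l * (P * 3)
      ≡⟨ cong (_+ suc l * (P * 3)) (begin-equality
           ∑ᵇ (λ s → (U s + 1) + l * 1)    ≡⟨ ∑ᵇ-cong (λ s → +-assoc (U s) 1 (l * 1)) ⟩
           ∑ᵇ (λ s → U s + (1 + l * 1))    ≡⟨ ∑ᵇ-distrib-+ U (λ _ → 1 + l * 1) ⟩
           T + ∑ᵇ {l} (λ _ → 1 + l * 1)    ≡⟨ cong (T +_) (∑ᵇ-const l (1 + l * 1)) ⟩
           T + P * (1 + l * 1)             ∎) ⟩
    T + P * (1 + l * 1) + suc l * (P * 3)
      ≤⟨ t+p[1+k]+[1+k]3p≤p*p T P l (∑ᵇ-increasing-pairs hubIndex) 8[1+l]≤P ⟩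
    P * P
      ≡⟨ ^-distribˡ-+-* 2 l l ⟨
    2 ^ (l + l)
      ≡⟨ cong (λ k → 2 ^ (l + k)) (+-identityʳ l) ⟨
    2 ^ (2 * l) ∎
    where
    open ≤-Reasoning
    U : Bits l → ℕ
    U s = ∑ᵇ (λ d → 𝟙[ hubIndex s < hubIndex (s ⊕ d) ])
    T : ℕ
    T = ∑ᵇ U

  separatingGraph : 8 * suc l ≤ P → SeparatingGraph l n
  separatingGraph 8[1+l]≤P =
    graph , DiameterAtMost⇒Connected graph 3 diameter≤3 , numEdges≤ 8[1+l]≤P , diameter≤3 ,
    index a , index b ,
    (λ sameView → a≁b (trans (sym (view-graph-from l a)) (trans (sameView l) (view-graph-from l b)))) ,
    (begin
      view graph (suc m) (index a) ≡⟨ view-graph-from (suc m) a ⟩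
      viewOn portGraph (suc m) a   ≡⟨ viewOn-bisimulation portGraph {Similar} similar-isGradedBisimulation (suc m) a b
                                        (refl , Agree-0ᵇ-unitᵇ (suc m)) ⟩
      viewOn portGraph (suc m) b   ≡⟨ view-graph-from (suc m) b ⟨
      view graph (suc m) (index b) ∎)
    where
    open ≡-Reasoning
    diameter≤3 : DiameterAtMost graph 3
    diameter≤3 = diameter-graph 3 walkWithin-3

8[7+k]≤2^[6+k] : ∀ k → 8 * (7 + k) ≤ 2 ^ (6 + k)
8[7+k]≤2^[6+k] zero    = m≤m+n 56 8
8[7+k]≤2^[6+k] (suc k) = begin
  8 * (8 + k)               ≡⟨ *-distribˡ-+ 8 1 (7 + k) ⟩
  8 + 8 * (7 + k)           ≤⟨ +-mono-≤ (≤-trans (m≤m*n 8 (7 + k)) (8[7+k]≤2^[6+k] k)) (8[7+k]≤2^[6+k] k) ⟩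
  2 ^ (6 + k) + 2 ^ (6 + k) ≡⟨ cong (2 ^ (6 + k) +_) (+-identityʳ (2 ^ (6 + k))) ⟨
  2 ^ (7 + k)               ∎
  where open ≤-Reasoning

proposition3p1 : (l : ℕ) → 6 ≤ l →
    Σ (PortGraph ((l + 2) * 2 ^ l)) λ G →
    Connected G × numEdges G ≤ 2 ^ (2 * l) × DiameterAtMost G 3 ×
    Σ (Fin ((l + 2) * 2 ^ l)) λ a → Σ (Fin ((l + 2) * 2 ^ l)) λ b →
    ¬ SameView G a b × view G (l ∸ 1) a ≡ view G (l ∸ 1) b
proposition3p1 l (s≤s (s≤s (s≤s (s≤s (s≤s (s≤s {n = k} z≤n)))))) =
  subst (SeparatingGraph l) (cong (_* 2 ^ l) (+-comm 2 l))
        (Construction.separatingGraph (4 + k) (8[7+k]≤2^[6+k] k))
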